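{- Let $w\in S_n$, let $v\subseteq w$ be a subword of size $m$ with positions $s_1<\cdots<s_m$ and entries $t_1<\cdots<t_m$, and set $u:=\mathrm{perm}(v)$. Then $\mathrm{wt}^{(\beta)}(B)=\mathrm{wt}^{(\beta)}(\varphi_v^w(B))$ for all $B\in\mathrm{bpd}(w;v)$, where $\varphi_v^w(B)_{i,j}=B_{s_i,t_j}$ ($1\le i,j\le m$).
   Context: Permutations are written in one-line notation. A bumpless pipe dream (BPD) of size $n$ is a tiling of the $n\times n$ grid (rows top to bottom, columns left to right; $B_{i,j}$ the tile in row $i$, column $j$) by six tiles: blank, cross, horizontal, vertical, r-elbow (joining south edge to east edge) and j-elbow (joining west edge to north edge), such that the segments form $n$ pipes moving only north and east, each entering through the bottom of one column and exiting through the right end of one row, one per column and per row. A pipe from column $j$ to row $i$ is denoted $j\rightarrow i$, and the permutation $w_B$ satisfies $w_B(i)=j$. $B$ is reduced if any two pipes cross at most once. For a reduced BPD $B$, the weight is $\mathrm{wt}^{(\beta)}(B)=(1+\beta)^{\#\{\text{j-elbow tiles of }B\}}$ (for reduced $B$ the number of blank tiles equals the length of its permutation, so this agrees with the general weight $\beta^{\#\text{blank}-\ell(w_B)}(1+\beta)^{\#\text{j-elbow}}$). A pipe $j\rightarrow i$ is removable if the tile at $(i,j)$ is an r-elbow and it is the only r-elbow in row $i$ and in column $j$. A subword $v\subseteq w$ is a subsequence $w(s_1)\cdots w(s_m)$ ($s_1<\cdots<s_m$), $\mathrm{perm}(v)$ its standardization. $\mathrm{bpd}(w;v)$ is the set of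 reduced BPDs with permutation $w$ whose set of removable pipes is exactly $\{w(x)\rightarrow x: x\notin\{s_1,\dots,s_m\}\}$. -}

module Defs where

open import Level using (Level)
open import Data.Bool using (Bool; true; false; _∧_; _∨_; if_then_else_)
open import Data.Nat using (ℕ; zero; suc; _+_; _*_; _∸_; _<_; _≤_; _<?_; _≟_; _≡ᵇ_)
open import Data.Fin using (Fin; toℕ; fromℕ<)
open import Data.Fin.Permutation using (Permutation′; _⟨$⟩ʳ_)
open import Data.List using (List; []; _∷_; length; map; allFin; filterᵇ)
open import Data.Nat.ListAction using (sum)
open import Data.Product using (_×_; _,_; proj₁; proj₂)
open import Data.Maybe using (Maybe; just; nothing)
open import Relation.Nullary using (yes; no; ¬_)
open import Relation.Binary.PropositionalEquality using (_≡_; _≢_)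
open import Algebra.Bundles using (CommutativeSemiring)

-- Tiles.  Rows and columns are 0-indexed (row 0 = top, column 0 = left).

data Tile : Set where
  blank cross horiz vert relbow jelbow : Tile

northE southE eastE westE : Tile → Bool
northE cross  = true
northE vert   = true
northE jelbow = true
northE _      = false
southE cross  = true
southE vert   = true
southE relbow = true
southE _      = false
eastE  cross  = true
eastE  horiz  = true
eastE  relbow = true
eastE  _      = false
westE  cross  = true
westE  horiz  = true
westE  jelbow = true
westE  _      = false

isJ : Tile → Bool
isJ jelbow = true
isJ _      = false

isCross : Tile → Bool
isCross cross = true
isCross _     = false

-- an n × n grid of tiles, B i j = tile in row i, column j
Grid : ℕ → Set
Grid n = Fin n → Fin n → Tile

get : ∀ {n} → Grid n → ℕ → ℕ → Tile
get {n} B i j with i <? n | j <? n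
... | yes p | yes q = B (fromℕ< p) (fromℕ< q)
... | _     | _     = blank

record IsBPD {n : ℕ} (B : Grid n) : Set where
  field
    horizMatch : ∀ i j → i < n → suc j < n → eastE (get B i j) ≡ westE (get B i (suc j))
    vertMatch  : ∀ i j → suc i < n → j < n → southE (get B i j) ≡ northE (get B (suc i) j)
    leftEmpty  : ∀ i → i < n → westE (get B i 0) ≡ false
    topEmpty   : ∀ j → j < n → northE (get B 0 j) ≡ false
    rightFull  : ∀ i → i < n → eastE (get B i (n ∸ 1)) ≡ true
    bottomFull : ∀ j → j < n → southE (get B (n ∸ 1) j) ≡ true

data Dir : Set where
  north east : Dir

next : Dir → Tile → Maybe Dir
next north vert   = just north
next north cross  = just north
next north relbow = just east
next east  horiz  = just east
next east  cross  = just east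
next east  jelbow = just north
next _     _      = nothing

cons : (ℕ × ℕ) → List (ℕ × ℕ) × Maybe ℕ → List (ℕ × ℕ) × Maybe ℕ
cons c (cs , r) = (c ∷ cs) , r

-- walk B fuel i j d : the pipe enters cell (i,j) moving in direction d;
-- returns the list of visited cells and (just r) if it exits the right
-- end of row r (nothing if it gets stuck / leaves elsewhere).
mutual
  walk : ∀ {n} → Grid n → ℕ → ℕ → ℕ → Dir → List (ℕ × ℕ) × Maybe ℕ
  walk B zero    i j d = [] , nothing
  walk B (suc f) i j d = cons (i , j) (continue B f i j (next d (get B i j)))

  continue : ∀ {n} → Grid n → ℕ → ℕ → ℕ → Maybe Dir → List (ℕ × ℕ) × Maybe ℕ
  continue B f i       j nothing      = [] , nothing
  continue B f zero    j (just north) = [] , nothing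
  continue B f (suc i) j (just north) = walk B f i j north
  continue {n} B f i   j (just east) with suc j ≟ n
  ... | yes _ = [] , just i
  ... | no  _ = walk B f i (suc j) east

pipe : ∀ {n} → Grid n → ℕ → List (ℕ × ℕ) × Maybe ℕ
pipe {n} B j = walk B (2 * n) (n ∸ 1) j north

HasPerm : ∀ {n} → Grid n → Permutation′ n → Set
HasPerm {n} B w = ∀ (x : Fin n) → proj₂ (pipe B (toℕ (w ⟨$⟩ʳ x))) ≡ just (toℕ x)

_==c_ : ℕ × ℕ → ℕ × ℕ → Bool
(a , b) ==c (c , d) = (a ≡ᵇ c) ∧ (b ≡ᵇ d)

memᵇ : ℕ × ℕ → List (ℕ × ℕ) → Bool
memᵇ c []       = false
memᵇ c (d ∷ ds) = (c ==c d) ∨ memᵇ c ds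

crossings : ∀ {n} → Grid n → ℕ → ℕ → List (ℕ × ℕ)
crossings B p q =
  filterᵇ (λ c → memᵇ c (proj₁ (pipe B q)) ∧ isCross (get B (proj₁ c) (proj₂ c)))
          (proj₁ (pipe B p))

Reduced : ∀ {n} → Grid n → Set
Reduced {n} B = ∀ p q → p < n → q < n → p ≢ q → length (crossings B p q) ≤ 1

IsReducedBPD : ∀ {n} → Grid n → Set
IsReducedBPD B = IsBPD B × Reduced B

Removable : ∀ {n} → Grid n → Permutation′ n → Fin n → Set
Removable {n} B w x =
  (B x (w ⟨$⟩ʳ x) ≡ relbow) ×
  (∀ (j : Fin n) → B x j ≡ relbow → j ≡ w ⟨$⟩ʳ x) ×
  (∀ (i : Fin n) → B i (w ⟨$⟩ʳ x) ≡ relbow → i ≡ x)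

NotPos : ∀ {m n} → (Fin m → Fin n) → Fin n → Set
NotPos s x = ∀ a → s a ≢ x

InBpd : ∀ {m n} → Permutation′ n → (Fin m → Fin n) → Grid n → Set
InBpd {m} {n} w s B =
  IsReducedBPD B × HasPerm B w ×
  (∀ (x : Fin n) → (Removable B w x → NotPos s x) × (NotPos s x → Removable B w x))

StrictlyIncreasing : ∀ {m n} → (Fin m → Fin n) → Set
StrictlyIncreasing {m} f = ∀ (a b : Fin m) → toℕ a < toℕ b → toℕ (f a) < toℕ (f b)

φ : ∀ {m n} → (Fin m → Fin n) → (Fin m → Fin n) → Grid n → Grid m
φ s t B a b = B (s a) (t b)

-- Weights, valued in an arbitrary commutative semiring with β ∈ R
-- (taking R = ℤ[β] recovers the polynomial weight).

countJ : ∀ {n} → Grid n → ℕ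
countJ {n} B = sum (map (λ i → sum (map (λ j → if isJ (B i j) then 1 else 0) (allFin n))) (allFin n))

module _ {c ℓ : Level} (R : CommutativeSemiring c ℓ) where
  open CommutativeSemiring R using (Carrier; 1#) renaming (_*_ to _⊗_; _+_ to _⊕_)

  pow : Carrier → ℕ → Carrier
  pow x zero    = 1#
  pow x (suc k) = x ⊗ pow x k

  wt : Carrier → ∀ {n} → Grid n → Carrier
  wt β B = pow (1# ⊕ β) (countJ B)

{-# OPTIONS --safe #-}
module Submission where

-- For a position x outside s the pipe w(x) → x is removable, so row x and column w(x) each
-- contain a single r-elbow. Edges match along a row or column, nothing enters at its start and
-- everything leaves at its end, so every other tile there passes its pipes straight through:
-- it is blank, a cross, horizontal or vertical. Because t lists the values of w on s, the deleted
-- columns are exactly the w(x) for deleted rows x. Cutting these straight rows and columns out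
-- therefore keeps all edges matching, and every pipe of φ(B) is the corresponding pipe of B with
-- its straight runs through deleted rows and columns removed. Hence crossings of φ(B) are
-- crossings of B, so φ(B) is reduced, and all j-elbows of B lie in kept rows and columns, so
-- both grids have the same weight.

open import Algebra.Bundles using (CommutativeSemiring)
open import Data.Bool using (Bool; true; false; T; _∧_; if_then_else_)
open import Data.Bool.Properties using (T-∧; T-∨)
open import Data.Empty using (⊥-elim)
open import Data.Fin using (Fin; toℕ; fromℕ<)
import Data.Fin as Fin
open import Data.Fin.Permutation using (Permutation′; _⟨$⟩ʳ_; _⟨$⟩ˡ_; inverseˡ; inverseʳ)
open import Data.Fin.Properties using (toℕ-fromℕ<; fromℕ<-toℕ; toℕ-injective; toℕ<n)
import Data.Fin.Properties as Fin
open import Data.List using (List; []; _∷_; length; map; tabulate; allFin)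
open import Data.List.Properties using (tabulate-cong; map-tabulate; map-cong)
open import Data.List.Relation.Binary.Sublist.Heterogeneous using (Sublist; _∷_; _∷ʳ_; minimum)
open import Data.List.Relation.Binary.Sublist.Heterogeneous.Properties using (length-mono-≤; ⊆-filter-Sublist)
open import Data.Maybe using (just; nothing)
open import Data.Nat using (ℕ; zero; suc; pred; _+_; _*_; _∸_; _<_; _≤_; z≤n; s≤s; _<?_; _≟_)
open import Data.Nat.ListAction using (sum)
open import Data.Nat.Properties
open import Data.Product using (_×_; _,_; proj₁; proj₂; ∃)
open import Data.Sum using (inj₁; inj₂)
open import Function using (_∘_)
open import Function.Bundles using (Equivalence)
open import Level using (Level)
open import Relation.Binary.Definitions using (tri<; tri≈; tri>)
open import Relation.Binary.PropositionalEquality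
open import Relation.Nullary using (¬_; yes; no)
open import Relation.Nullary.Decidable using (T?)

open import Defs

downward-induction : ∀ {p} (P : ℕ → Set p) {n} → (∀ k → suc k ≡ n → P k) →
                     (∀ k → suc k < n → P (suc k) → P k) → ∀ k → k < n → P k
downward-induction P {n} last step k k<n = go (n ∸ suc k) k (m+[n∸m]≡n k<n)
  where
  go : ∀ d k → suc k + d ≡ n → P k
  go zero    k eq = last k (trans (sym (+-identityʳ (suc k))) eq)
  go (suc d) k eq = step k 2+k≤n (go d (suc k) (trans (sym (+-suc (suc k) d)) eq))
    where
    2+k≤n : suc (suc k) ≤ n
    2+k≤n = ≤-trans (s≤s (s≤s (m≤m+n k d))) (≤-reflexive (trans (cong suc (sym (+-suc k d))) eq))

pred<n : ∀ {i n} → i < n → pred n < n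
pred<n {n = suc n} _ = n<1+n n

suc-pred-of : ∀ {i n} → i < n → suc (pred n) ≡ n
suc-pred-of {n = suc n} _ = refl

module _ {m n : ℕ} (s : Fin m → Fin (suc n)) (positive : ∀ a → 0 < toℕ (s a)) where

  shift-down : Fin m → Fin n
  shift-down a with s a | positive a
  ... | Fin.suc i | _ = i

  suc-shift-down : ∀ a → Fin.suc (shift-down a) ≡ s a
  suc-shift-down a with s a | positive a
  ... | Fin.suc i | _ = refl

  shift-down-increasing : StrictlyIncreasing s → StrictlyIncreasing shift-down
  shift-down-increasing increasing a b a<b = ≤-pred
    (subst₂ _<_ (cong toℕ (sym (suc-shift-down a))) (cong toℕ (sym (suc-shift-down b))) (increasing a b a<b))

sum-tabulate-restrict : ∀ {m n} (s : Fin m → Fin n) → StrictlyIncreasing s → (f : Fin n → ℕ) →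
                        (∀ i → NotPos s i → f i ≡ 0) → sum (tabulate f) ≡ sum (tabulate (f ∘ s))
sum-tabulate-restrict {zero}  {zero}  s _ _ _ = refl
sum-tabulate-restrict {suc m} {zero}  s _ _ _ with s Fin.zero
... | ()
sum-tabulate-restrict {zero}  {suc n} s _ f vanish =
  cong₂ _+_ (vanish Fin.zero λ ())
            (sum-tabulate-restrict {zero} (λ ()) (λ ()) (f ∘ Fin.suc) (λ i _ → vanish (Fin.suc i) λ ()))
sum-tabulate-restrict {suc m} {suc n} s increasing f vanish with s Fin.zero Fin.≟ Fin.zero
... | yes s₀≡0 =
  cong₂ _+_ (cong f (sym s₀≡0))
    (trans (sum-tabulate-restrict s′ (shift-down-increasing _ positive (λ a b a<b → increasing _ _ (s≤s a<b)))
                                  (f ∘ Fin.suc) vanish′)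
           (cong sum (tabulate-cong (cong f ∘ suc-shift-down _ positive))))
  where
  positive : ∀ a → 0 < toℕ (s (Fin.suc a))
  positive a =
    subst (λ i → toℕ i < toℕ (s (Fin.suc a))) s₀≡0 (increasing Fin.zero (Fin.suc a) (s≤s z≤n))
  s′ = shift-down (s ∘ Fin.suc) positive
  vanish′ : ∀ i → NotPos s′ i → f (Fin.suc i) ≡ 0
  vanish′ i notPos = vanish (Fin.suc i) λ
    { Fin.zero    s₀≡suc → 0≢1+n (cong toℕ (trans (sym s₀≡0) s₀≡suc))
    ; (Fin.suc a) s≡suc  → notPos a (Fin.suc-injective (trans (suc-shift-down _ positive a) s≡suc)) }
... | no s₀≢0 =
  trans (cong₂ _+_ (vanish Fin.zero (λ a s≡0 → <⇒≢ (positive a) (sym (cong toℕ s≡0))))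
                   (sum-tabulate-restrict s′ (shift-down-increasing s positive increasing) (f ∘ Fin.suc) vanish′))
        (cong sum (tabulate-cong (cong f ∘ suc-shift-down s positive)))
  where
  positive : ∀ a → 0 < toℕ (s a)
  positive Fin.zero    = n≢0⇒n>0 (s₀≢0 ∘ Fin.toℕ-injective)
  positive (Fin.suc a) = <-trans (positive Fin.zero) (increasing Fin.zero (Fin.suc a) (s≤s z≤n))
  s′ = shift-down s positive
  vanish′ : ∀ i → NotPos s′ i → f (Fin.suc i) ≡ 0
  vanish′ i notPos = vanish (Fin.suc i) λ a s≡suc →
    notPos a (Fin.suc-injective (trans (suc-shift-down s positive a) s≡suc))

sum-map-allFin-restrict : ∀ {m n} (s : Fin m → Fin n) → StrictlyIncreasing s → (f : Fin n → ℕ) →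
                          (∀ i → NotPos s i → f i ≡ 0) →
                          sum (map f (allFin n)) ≡ sum (map (f ∘ s) (allFin m))
sum-map-allFin-restrict {m} {n} s increasing f vanish = begin
  sum (map f (allFin n))         ≡⟨ cong sum (map-tabulate (λ i → i) f) ⟩
  sum (tabulate f)               ≡⟨ sum-tabulate-restrict s increasing f vanish ⟩
  sum (tabulate (f ∘ s))         ≡⟨ cong sum (map-tabulate (λ i → i) (f ∘ s)) ⟨
  sum (map (f ∘ s) (allFin m))   ∎
  where open ≡-Reasoning

sum-map-zero : ∀ {A : Set} (f : A → ℕ) → (∀ x → f x ≡ 0) → ∀ xs → sum (map f xs) ≡ 0
sum-map-zero f vanish []       = refl
sum-map-zero f vanish (x ∷ xs) = cong₂ _+_ (vanish x) (sum-map-zero f vanish xs)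

data Straight : Tile → Set where
  blank : Straight blank
  cross : Straight cross
  horiz : Straight horiz
  vert  : Straight vert

straight⇒westE≡eastE : ∀ {τ} → Straight τ → westE τ ≡ eastE τ
straight⇒westE≡eastE blank = refl
straight⇒westE≡eastE cross = refl
straight⇒westE≡eastE horiz = refl
straight⇒westE≡eastE vert  = refl

straight⇒northE≡southE : ∀ {τ} → Straight τ → northE τ ≡ southE τ
straight⇒northE≡southE blank = refl
straight⇒northE≡southE cross = refl
straight⇒northE≡southE horiz = refl
straight⇒northE≡southE vert  = refl

westE≡eastE⇒straight : ∀ τ → westE τ ≡ eastE τ → Straight τ
westE≡eastE⇒straight blank _ = blank
westE≡eastE⇒straight cross _ = cross
westE≡eastE⇒straight horiz _ = horiz
westE≡eastE⇒straight vert  _ = vert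

northE≡southE⇒straight : ∀ τ → northE τ ≡ southE τ → Straight τ
northE≡southE⇒straight blank _ = blank
northE≡southE⇒straight cross _ = cross
northE≡southE⇒straight horiz _ = horiz
northE≡southE⇒straight vert  _ = vert

straight⇒¬isJ : ∀ {τ} → Straight τ → isJ τ ≡ false
straight⇒¬isJ blank = refl
straight⇒¬isJ cross = refl
straight⇒¬isJ horiz = refl
straight⇒¬isJ vert  = refl

entryE exitE : Dir → Tile → Bool
entryE north = southE
entryE east  = westE
exitE  north = northE
exitE  east  = eastE

next-straight : ∀ {τ} d → Straight τ → entryE d τ ≡ true → next d τ ≡ just d
next-straight north cross _ = refl
next-straight north vert  _ = refl
next-straight east  cross _ = refl
next-straight east  horiz _ = refl
next-straight north blank ()
next-straight north horiz ()
next-straight east  blank ()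
next-straight east  vert  ()

next⇒exitE : ∀ d τ {d′} → next d τ ≡ just d′ → exitE d′ τ ≡ true
next⇒exitE north vert   refl = refl
next⇒exitE north cross  refl = refl
next⇒exitE north relbow refl = refl
next⇒exitE east  horiz  refl = refl
next⇒exitE east  cross  refl = refl
next⇒exitE east  jelbow refl = refl
next⇒exitE north blank  ()
next⇒exitE north horiz  ()
next⇒exitE north jelbow ()
next⇒exitE east  blank  ()
next⇒exitE east  vert   ()
next⇒exitE east  relbow ()

-- A row is read with (inE , outE) = (westE , eastE), a column with (northE , southE).
record IsLine (inE outE : Tile → Bool) (n : ℕ) (tile : ℕ → Tile) : Set where
  field
    match : ∀ k → suc k < n → outE (tile k) ≡ inE (tile (suc k))
    start : inE (tile 0) ≡ false
    end   : ∀ {k} → suc k ≡ n → outE (tile k) ≡ true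

IsLine-cong : ∀ {inE outE n f g} → (∀ k → f k ≡ g k) → IsLine inE outE n f → IsLine inE outE n g
IsLine-cong {inE} {outE} f≗g line = record
  { match = λ k 1+k<n → subst₂ _≡_ (cong outE (f≗g k)) (cong inE (f≗g (suc k))) (match k 1+k<n)
  ; start = subst (λ τ → inE τ ≡ false) (f≗g 0) start
  ; end   = λ 1+k≡n → subst (λ τ → outE τ ≡ true) (f≗g _) (end 1+k≡n)
  }
  where open IsLine line

Passes : (Tile → Bool) → (Tile → Bool) → Tile → Set
Passes inE outE τ = inE τ ≡ outE τ

StartsOnlyAtRelbow : (Tile → Bool) → (Tile → Bool) → Set
StartsOnlyAtRelbow inE outE = ∀ τ → inE τ ≡ false → outE τ ≡ true → τ ≡ relbow

row-startsOnlyAtRelbow : StartsOnlyAtRelbow westE eastE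
row-startsOnlyAtRelbow relbow _ _ = refl
row-startsOnlyAtRelbow blank  _ ()
row-startsOnlyAtRelbow vert   _ ()
row-startsOnlyAtRelbow jelbow _ ()

column-startsOnlyAtRelbow : StartsOnlyAtRelbow northE southE
column-startsOnlyAtRelbow relbow _ _ = refl
column-startsOnlyAtRelbow blank  _ ()
column-startsOnlyAtRelbow horiz  _ ()
column-startsOnlyAtRelbow jelbow _ ()

module _ {inE outE : Tile → Bool} {n : ℕ} {tile : ℕ → Tile} (line : IsLine inE outE n tile) where
  open IsLine line

  transmit : ∀ {i j} → i < j → j < n → (∀ k → i < k → k < j → Passes inE outE (tile k)) →
             outE (tile i) ≡ inE (tile j)
  transmit {i} {suc j} i<1+j 1+j<n pass with m≤n⇒m<n∨m≡n (≤-pred i<1+j)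
  ... | inj₂ refl = match i 1+j<n
  ... | inj₁ i<j  = begin
    outE (tile i)       ≡⟨ transmit i<j (<-trans (n<1+n j) 1+j<n) (λ k lo hi → pass k lo (m<n⇒m<1+n hi)) ⟩
    inE  (tile j)       ≡⟨ pass j i<j (n<1+n j) ⟩
    outE (tile j)       ≡⟨ match j 1+j<n ⟩
    inE  (tile (suc j)) ∎
    where open ≡-Reasoning

  closed-before : ∀ {j} → j < n → (∀ k → k < j → Passes inE outE (tile k)) → inE (tile j) ≡ false
  closed-before {zero}  _     _    = start
  closed-before {suc j} 1+j<n pass = begin
    inE  (tile (suc j)) ≡⟨ transmit (s≤s z≤n) 1+j<n (λ k _ hi → pass k hi) ⟨
    outE (tile 0)       ≡⟨ pass 0 (s≤s z≤n) ⟨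
    inE  (tile 0)       ≡⟨ start ⟩
    false               ∎
    where open ≡-Reasoning

  open-after : ∀ {i} → i < n → (∀ k → i < k → k < n → Passes inE outE (tile k)) →
               outE (tile i) ≡ true
  open-after {i} i<n pass = downward-induction (λ k → i ≤ k → outE (tile k) ≡ true)
    (λ k 1+k≡n _ → end 1+k≡n)
    (λ k 1+k<n ih i≤k → trans (match k 1+k<n)
                                (trans (pass (suc k) (s≤s i≤k) 1+k<n) (ih (m≤n⇒m≤1+n i≤k))))
    i i<n ≤-refl

  module _ (startsAtRelbow : StartsOnlyAtRelbow inE outE) {c : ℕ}
           (only-relbow : ∀ k → k < n → tile k ≡ relbow → k ≡ c) where

    private
      not-relbow : ∀ {k} → k < n → k ≢ c → tile k ≢ relbow
      not-relbow k<n k≢c relbow-at-k = k≢c (only-relbow _ k<n relbow-at-k)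

      stays-closed : ∀ {τ} → τ ≢ relbow → inE τ ≡ false → outE τ ≡ false
      stays-closed {τ} τ≢relbow in≡false with outE τ in out≡
      ... | false = refl
      ... | true  = ⊥-elim (τ≢relbow (startsAtRelbow τ in≡false out≡))

      was-open : ∀ {τ} → τ ≢ relbow → outE τ ≡ true → inE τ ≡ true
      was-open {τ} τ≢relbow out≡true with inE τ in in≡
      ... | true  = refl
      ... | false = ⊥-elim (τ≢relbow (startsAtRelbow τ in≡ out≡true))

      closed-left : ∀ k → k < n → k < c → inE (tile k) ≡ false
      closed-left zero    _     _     = start
      closed-left (suc k) 1+k<n 1+k<c =
        trans (sym (match k 1+k<n)) (stays-closed (not-relbow k<n (<⇒≢ k<c)) (closed-left k k<n k<c))
        where
        k<n = <-trans (n<1+n k) 1+k<n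
        k<c = <-trans (n<1+n k) 1+k<c

      open-right : ∀ k → k < n → c < k → outE (tile k) ≡ true
      open-right = downward-induction (λ k → c < k → outE (tile k) ≡ true) (λ _ 1+k≡n _ → end 1+k≡n)
        (λ k 1+k<n ih c<k → trans (match k 1+k<n)
          (was-open (not-relbow 1+k<n (>⇒≢ (m<n⇒m<1+n c<k))) (ih (m<n⇒m<1+n c<k))))

    passes-off-relbow : ∀ k → k < n → k ≢ c → Passes inE outE (tile k)
    passes-off-relbow k k<n k≢c with <-cmp k c
    ... | tri< k<c _ _ = let closed = closed-left k k<n k<c in
                         trans closed (sym (stays-closed (not-relbow k<n k≢c) closed))
    ... | tri≈ _ k≡c _ = ⊥-elim (k≢c k≡c)
    ... | tri> _ _ c<k = let open′ = open-right k k<n c<k in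
                         trans (was-open (not-relbow k<n k≢c) open′) (sym open′)

module Increasing {m n : ℕ} (s : Fin m → Fin n) (increasing : StrictlyIncreasing s) where

  -- Indices outside [0, m) are sent to n, outside the grid, where `get` is blank.
  lift : ℕ → ℕ
  lift a with a <? m
  ... | yes a<m = toℕ (s (fromℕ< a<m))
  ... | no  _   = n

  lift-fromℕ< : ∀ {a} (a<m : a < m) → lift a ≡ toℕ (s (fromℕ< a<m))
  lift-fromℕ< {a} a<m with a <? m
  ... | yes _   = refl
  ... | no  a≮m = ⊥-elim (a≮m a<m)

  lift-toℕ : ∀ a → lift (toℕ a) ≡ toℕ (s a)
  lift-toℕ a = trans (lift-fromℕ< (toℕ<n a)) (cong (toℕ ∘ s) (fromℕ<-toℕ a (toℕ<n a)))

  lift<n : ∀ {a} → a < m → lift a < n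
  lift<n a<m = subst (_< n) (sym (lift-fromℕ< a<m)) (toℕ<n _)

  lift-mono-< : ∀ {a b} → a < b → b < m → lift a < lift b
  lift-mono-< {a} {b} a<b b<m = subst₂ _<_ (sym (lift-fromℕ< a<m)) (sym (lift-fromℕ< b<m))
    (increasing _ _ (subst₂ _<_ (sym (toℕ-fromℕ< a<m)) (sym (toℕ-fromℕ< b<m)) a<b))
    where a<m = <-trans a<b b<m

  lift-mono-≤ : ∀ {a b} → a ≤ b → b < m → lift a ≤ lift b
  lift-mono-≤ a≤b b<m with m≤n⇒m<n∨m≡n a≤b
  ... | inj₁ a<b  = <⇒≤ (lift-mono-< a<b b<m)
  ... | inj₂ refl = ≤-refl

  lift-injective : ∀ {a b} → a < m → b < m → lift a ≡ lift b → a ≡ b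
  lift-injective {a} {b} a<m b<m eq with <-cmp a b
  ... | tri< a<b _ _ = ⊥-elim (<⇒≢ (lift-mono-< a<b b<m) eq)
  ... | tri≈ _ a≡b _ = a≡b
  ... | tri> _ _ b<a = ⊥-elim (>⇒≢ (lift-mono-< b<a a<m) eq)

  Skipped : ℕ → Set
  Skipped r = ∀ a → toℕ (s a) ≢ r

  skipped-between : ∀ {a r} → suc a < m → lift a < r → r < lift (suc a) → Skipped r
  skipped-between {a} 1+a<m lo hi a′ sa′≡r with ≤-<-connex (toℕ a′) a
  ... | inj₁ a′≤a = <⇒≱ lo (subst (_≤ lift a) (trans (lift-toℕ a′) sa′≡r)
                                  (lift-mono-≤ a′≤a (<-trans (n<1+n a) 1+a<m)))
  ... | inj₂ a<a′ = <⇒≱ hi (subst (lift (suc a) ≤_) (trans (lift-toℕ a′) sa′≡r)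
                                  (lift-mono-≤ a<a′ (toℕ<n a′)))

  skipped-below : ∀ {r} → r < lift 0 → Skipped r
  skipped-below hi a sa≡r =
    <⇒≱ hi (subst (lift 0 ≤_) (trans (lift-toℕ a) sa≡r) (lift-mono-≤ z≤n (toℕ<n a)))

  skipped-above : ∀ {l r} → suc l ≡ m → lift l < r → Skipped r
  skipped-above {l} refl lo a sa≡r =
    <⇒≱ lo (subst (_≤ lift l) (trans (lift-toℕ a) sa≡r) (lift-mono-≤ (≤-pred (toℕ<n a)) ≤-refl))

  module _ {inE outE : Tile → Bool} {tile : ℕ → Tile} (line : IsLine inE outE n tile)
           (passes-skipped : ∀ k → k < n → Skipped k → Passes inE outE (tile k)) where

    isLine-restrict : 0 < m → IsLine inE outE m (tile ∘ lift)
    isLine-restrict 0<m = record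
      { match = λ k 1+k<m → transmit line (lift-mono-< (n<1+n k) 1+k<m) (lift<n 1+k<m)
                  (λ c lo hi → passes-skipped c (<-trans hi (lift<n 1+k<m)) (skipped-between 1+k<m lo hi))
      ; start = closed-before line (lift<n 0<m)
                  (λ c hi → passes-skipped c (<-trans hi (lift<n 0<m)) (skipped-below hi))
      ; end   = λ 1+k≡m → open-after line (lift<n (≤-reflexive 1+k≡m))
                  (λ c lo c<n → passes-skipped c c<n (skipped-above 1+k≡m lo))
      }

module _ {n : ℕ} (B : Grid n) where

  get-fromℕ< : ∀ {i j} (i<n : i < n) (j<n : j < n) → get B i j ≡ B (fromℕ< i<n) (fromℕ< j<n)
  get-fromℕ< {i} {j} i<n j<n with i <? n | j <? n
  ... | yes _   | yes _   = refl
  ... | no  i≮n | _       = ⊥-elim (i≮n i<n)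
  ... | yes _   | no  j≮n = ⊥-elim (j≮n j<n)

  get-toℕ : ∀ i j → get B (toℕ i) (toℕ j) ≡ B i j
  get-toℕ i j =
    trans (get-fromℕ< (toℕ<n i) (toℕ<n j))
          (cong₂ B (fromℕ<-toℕ i (toℕ<n i)) (fromℕ<-toℕ j (toℕ<n j)))

  get-outside : ∀ {i j} → ¬ (i < n × j < n) → get B i j ≡ blank
  get-outside {i} {j} outside with i <? n | j <? n
  ... | yes i<n | yes j<n = ⊥-elim (outside (i<n , j<n))
  ... | no  _   | _       = refl
  ... | yes _   | no  _   = refl

  row-isLine : IsBPD B → ∀ {i} → i < n → IsLine westE eastE n (get B i)
  row-isLine bpd {i} i<n = record
    { match = λ k 1+k<n → horizMatch i k i<n 1+k<n
    ; start = leftEmpty i i<n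
    ; end   = λ { refl → rightFull i i<n }
    }
    where open IsBPD bpd

  column-isLine : IsBPD B → ∀ {j} → j < n → IsLine northE southE n (λ k → get B k j)
  column-isLine bpd {j} j<n = record
    { match = λ k 1+k<n → vertMatch k j 1+k<n j<n
    ; start = topEmpty j j<n
    ; end   = λ { refl → bottomFull j j<n }
    }
    where open IsBPD bpd

  isBPD-fromLines : (∀ {i} → i < n → IsLine westE eastE n (get B i)) →
                    (∀ {j} → j < n → IsLine northE southE n (λ k → get B k j)) → IsBPD B
  isBPD-fromLines row column = record
    { horizMatch = λ i k i<n 1+k<n → IsLine.match (row i<n) k 1+k<n
    ; vertMatch  = λ k j 1+k<n j<n → IsLine.match (column j<n) k 1+k<n
    ; leftEmpty  = λ i i<n → IsLine.start (row i<n)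
    ; topEmpty   = λ j j<n → IsLine.start (column j<n)
    ; rightFull  = λ i i<n → IsLine.end (row i<n) (suc-pred-of i<n)
    ; bottomFull = λ j j<n → IsLine.end (column j<n) (suc-pred-of j<n)
    }

module _ {n : ℕ} {B : Grid n} (w : Permutation′ n) {x : Fin n} (removable : Removable B w x) where

  private
    get-row : ∀ {k} (k<n : k < n) → get B (toℕ x) k ≡ B x (fromℕ< k<n)
    get-row k<n = trans (get-fromℕ< B (toℕ<n x) k<n) (cong (λ i → B i _) (fromℕ<-toℕ x (toℕ<n x)))

    get-column : ∀ {k} (k<n : k < n) → get B k (toℕ (w ⟨$⟩ʳ x)) ≡ B (fromℕ< k<n) (w ⟨$⟩ʳ x)
    get-column k<n = trans (get-fromℕ< B k<n (toℕ<n _)) (cong (B _) (fromℕ<-toℕ _ (toℕ<n _)))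

    only-relbow-in-row : ∀ k → k < n → get B (toℕ x) k ≡ relbow → k ≡ toℕ (w ⟨$⟩ʳ x)
    only-relbow-in-row k k<n relbow-at-k =
      trans (sym (toℕ-fromℕ< k<n))
            (cong toℕ (proj₁ (proj₂ removable) _ (trans (sym (get-row k<n)) relbow-at-k)))

    only-relbow-in-column : ∀ k → k < n → get B k (toℕ (w ⟨$⟩ʳ x)) ≡ relbow → k ≡ toℕ x
    only-relbow-in-column k k<n relbow-at-k =
      trans (sym (toℕ-fromℕ< k<n))
            (cong toℕ (proj₂ (proj₂ removable) _ (trans (sym (get-column k<n)) relbow-at-k)))

  module _ (bpd : IsBPD B) where

    removable-row-straight : ∀ k → k < n → k ≢ toℕ (w ⟨$⟩ʳ x) → Straight (get B (toℕ x) k)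
    removable-row-straight k k<n k≢wx = westE≡eastE⇒straight _
      (passes-off-relbow (row-isLine B bpd (toℕ<n x)) row-startsOnlyAtRelbow only-relbow-in-row k k<n k≢wx)

    removable-column-straight : ∀ k → k < n → k ≢ toℕ x → Straight (get B k (toℕ (w ⟨$⟩ʳ x)))
    removable-column-straight k k<n k≢x = northE≡southE⇒straight _
      (passes-off-relbow (column-isLine B bpd (toℕ<n _)) column-startsOnlyAtRelbow only-relbow-in-column
                         k k<n k≢x)

    removable-row-noJ : ∀ j → isJ (B x j) ≡ false
    removable-row-noJ j with toℕ j ≟ toℕ (w ⟨$⟩ʳ x)
    ... | yes j≡wx = cong isJ (trans (cong (B x) (toℕ-injective j≡wx)) (proj₁ removable))
    ... | no  j≢wx = subst (λ τ → isJ τ ≡ false) (get-toℕ B x j)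
                       (straight⇒¬isJ (removable-row-straight (toℕ j) (toℕ<n j) j≢wx))

module _ {k : ℕ} (G : Grid k) where

  walk-step : ∀ g i j d {d′} → next d (get G i j) ≡ just d′ →
              proj₁ (walk G (suc g) i j d) ≡ (i , j) ∷ proj₁ (continue G g i j (just d′))
  walk-step g i j d next≡ = cong (λ md → (i , j) ∷ proj₁ (continue G g i j md)) next≡

  -- The case split on the row only mirrors the clauses of `continue`.
  continue-east : ∀ g i j → suc j < k → continue G g i j (just east) ≡ walk G g i (suc j) east
  continue-east g zero    j 1+j<k with suc j ≟ k
  ... | yes 1+j≡k = ⊥-elim (<-irrefl 1+j≡k 1+j<k)
  ... | no  _     = refl
  continue-east g (suc i) j 1+j<k with suc j ≟ k
  ... | yes 1+j≡k = ⊥-elim (<-irrefl 1+j≡k 1+j<k)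
  ... | no  _     = refl

  continue-exit : ∀ g i j → suc j ≡ k → continue G g i j (just east) ≡ ([] , just i)
  continue-exit g zero    j 1+j≡k with suc j ≟ k
  ... | yes _     = refl
  ... | no  1+j≢k = ⊥-elim (1+j≢k 1+j≡k)
  continue-exit g (suc i) j 1+j≡k with suc j ≟ k
  ... | yes _     = refl
  ... | no  1+j≢k = ⊥-elim (1+j≢k 1+j≡k)

module Walks {n : ℕ} (B : Grid n) (bpd : IsBPD B) {A : Set} (R : A → ℕ × ℕ → Set) where
  open IsBPD bpd

  -- Every step decreases the row or increases the column, so fuel i + (n ∸ j) lets the walk leave the grid.
  EmbedsInWalk : List A → ℕ → ℕ → Dir → Set
  EmbedsInWalk L i j d = ∀ g → i + (n ∸ j) ≤ g → Sublist R L (proj₁ (walk B g i j d))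

  fuel-positive : ∀ {i j} → j < n → ¬ (i + (n ∸ j) ≤ 0)
  fuel-positive {i} {j} j<n fuel = <⇒≱ (m<n⇒0<n∸m j<n) (≤-trans (m≤n+m (n ∸ j) i) fuel)

  fuel-east : ∀ {i j g} → j < n → i + (n ∸ j) ≤ suc g → i + (n ∸ suc j) ≤ g
  fuel-east {i} {j} {g} j<n fuel =
    ≤-pred (subst (_≤ suc g) (trans (cong (i +_) (+-∸-assoc 1 j<n)) (+-suc i _)) fuel)

  mutual
    north-run : ∀ {L i₀ i j} → j < n → i₀ ≤ i → i < n →
                (∀ r → i₀ < r → r ≤ i → Straight (get B r j)) → southE (get B i j) ≡ true →
                EmbedsInWalk L i₀ j north → EmbedsInWalk L i j north
    north-run j<n i₀≤i i<n straight south embeds g fuel with m≤n⇒m<n∨m≡n i₀≤i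
    ... | inj₂ refl = embeds g fuel
    ... | inj₁ i₀<i = north-step j<n i₀<i i<n straight south embeds g fuel

    north-step : ∀ {L i₀ i j} → j < n → i₀ < i → i < n →
                 (∀ r → i₀ < r → r ≤ i → Straight (get B r j)) → southE (get B i j) ≡ true →
                 EmbedsInWalk L i₀ j north → EmbedsInWalk L i j north
    north-step j<n _ _ _ _ _ zero fuel = ⊥-elim (fuel-positive j<n fuel)
    north-step {L} {i = suc i} {j} j<n (s≤s i₀≤i) 1+i<n straight south embeds (suc g) fuel =
      subst (Sublist R L) (sym (walk-step B g (suc i) j north (next-straight north straight-here south)))
        (_ ∷ʳ north-run j<n i₀≤i (<-trans (n<1+n i) 1+i<n) (λ r lo hi → straight r lo (m≤n⇒m≤1+n hi))
                south-above embeds g (≤-pred fuel))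
      where
      straight-here = straight (suc i) (s≤s i₀≤i) ≤-refl
      south-above : southE (get B i j) ≡ true
      south-above = trans (vertMatch i j 1+i<n j<n) (trans (straight⇒northE≡southE straight-here) south)

  mutual
    east-run : ∀ {L i j j₁} → i < n → j ≤ j₁ → j₁ < n →
               (∀ c → j ≤ c → c < j₁ → Straight (get B i c)) → westE (get B i j) ≡ true →
               EmbedsInWalk L i j₁ east → EmbedsInWalk L i j east
    east-run i<n j≤j₁ j₁<n straight west embeds g fuel with m≤n⇒m<n∨m≡n j≤j₁
    ... | inj₂ refl = embeds g fuel
    ... | inj₁ j<j₁ = east-step i<n j<j₁ j₁<n straight west embeds g fuel

    east-step : ∀ {L i j j₁} → i < n → j < j₁ → j₁ < n →
                (∀ c → j ≤ c → c < j₁ → Straight (get B i c)) → westE (get B i j) ≡ true →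
                EmbedsInWalk L i j₁ east → EmbedsInWalk L i j east
    east-step i<n j<j₁ j₁<n _ _ _ zero fuel = ⊥-elim (fuel-positive (<-trans j<j₁ j₁<n) fuel)
    east-step {L} {i} {j} i<n j<j₁ j₁<n straight west embeds (suc g) fuel =
      subst (Sublist R L) (sym (trans (walk-step B g i j east (next-straight east straight-here west))
                                      (cong (λ c → (i , j) ∷ proj₁ c) (continue-east B g i j 1+j<n))))
        (_ ∷ʳ east-run i<n j<j₁ j₁<n (λ c lo hi → straight c (<⇒≤ lo) hi) west-next embeds g
                (fuel-east (<-trans j<j₁ j₁<n) fuel))
      where
      1+j<n = ≤-<-trans j<j₁ j₁<n
      straight-here = straight j ≤-refl j<j₁
      west-next : westE (get B i (suc j)) ≡ true
      west-next = trans (sym (horizMatch i j i<n 1+j<n)) (trans (sym (straight⇒westE≡eastE straight-here)) west)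

  north-gap : ∀ {L i₀ r j} → j < n → i₀ < r → r < n →
              (∀ k → i₀ < k → k < r → Straight (get B k j)) → northE (get B r j) ≡ true →
              EmbedsInWalk L i₀ j north →
              ∀ g → r + (n ∸ j) ≤ suc g → Sublist R L (proj₁ (continue B g r j (just north)))
  north-gap {r = suc i} {j} j<n (s≤s i₀≤i) r<n straight north-open embeds g fuel =
    north-run j<n i₀≤i (<-trans (n<1+n i) r<n) (λ k lo hi → straight k lo (s≤s hi))
      (trans (vertMatch i j r<n j<n) north-open) embeds g (≤-pred fuel)

  east-gap : ∀ {L i j₀ j₁} → i < n → j₀ < j₁ → j₁ < n →
             (∀ k → j₀ < k → k < j₁ → Straight (get B i k)) → eastE (get B i j₀) ≡ true →
             EmbedsInWalk L i j₁ east →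
             ∀ g → i + (n ∸ j₀) ≤ suc g → Sublist R L (proj₁ (continue B g i j₀ (just east)))
  east-gap {L} {i} {j₀} i<n j₀<j₁ j₁<n straight east-open embeds g fuel =
    subst (Sublist R L) (sym (cong proj₁ (continue-east B g i j₀ 1+j₀<n)))
      (east-run i<n j₀<j₁ j₁<n straight (trans (sym (horizMatch i j₀ i<n 1+j₀<n)) east-open) embeds g
        (fuel-east (<-trans j₀<j₁ j₁<n) fuel))
    where 1+j₀<n = ≤-<-trans j₀<j₁ j₁<n

==c⇒≡ : ∀ c d → T (c ==c d) → c ≡ d
==c⇒≡ (a , b) (a′ , b′) c==d = cong₂ _,_ (≡ᵇ⇒≡ a a′ (proj₁ both)) (≡ᵇ⇒≡ b b′ (proj₂ both))
  where both = Equivalence.to T-∧ c==d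

==c-refl : ∀ c → T (c ==c c)
==c-refl (a , b) = Equivalence.from T-∧ (≡⇒≡ᵇ a a refl , ≡⇒≡ᵇ b b refl)

memᵇ-Sublist : ∀ (F : ℕ × ℕ → ℕ × ℕ) {xs ys c} → Sublist (λ c d → F c ≡ d) xs ys →
               T (memᵇ c xs) → T (memᵇ (F c) ys)
memᵇ-Sublist F (y ∷ʳ sub) c∈xs = Equivalence.from T-∨ (inj₂ (memᵇ-Sublist F sub c∈xs))
memᵇ-Sublist F {x ∷ xs} {c = c} (refl ∷ sub) c∈x∷xs with Equivalence.to (T-∨ {c ==c x}) c∈x∷xs
... | inj₁ c==x =
  Equivalence.from T-∨ (inj₁ (subst (λ d → T (F c ==c F d)) (==c⇒≡ c x c==x) (==c-refl (F c))))
... | inj₂ c∈xs = Equivalence.from T-∨ (inj₂ (memᵇ-Sublist F sub c∈xs))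

module Subword {m n : ℕ} (w : Permutation′ n) (s t : Fin m → Fin n)
  (s-increasing : StrictlyIncreasing s) (t-increasing : StrictlyIncreasing t)
  (w∘s⊆t : ∀ a → ∃ λ b → w ⟨$⟩ʳ s a ≡ t b) (t⊆w∘s : ∀ b → ∃ λ a → t b ≡ w ⟨$⟩ʳ s a)
  (B : Grid n) (bpd : IsBPD B) (removable : ∀ x → NotPos s x → Removable B w x) where

  module Rows    = Increasing s s-increasing
  module Columns = Increasing t t-increasing
  open IsBPD bpd

  row col : ℕ → ℕ
  row = Rows.lift
  col = Columns.lift

  φB : Grid m
  φB = φ s t B

  get-φ : ∀ a b → get φB a b ≡ get B (row a) (col b)
  get-φ a b with a <? m | b <? m
  ... | yes _ | yes _ = sym (get-toℕ B _ _)
  ... | no  _ | _     = sym (get-outside B (λ (n<n , _) → <-irrefl refl n<n))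
  ... | yes _ | no  _ = sym (get-outside B (λ (_ , n<n) → <-irrefl refl n<n))

  w-injective : ∀ {x y} → w ⟨$⟩ʳ x ≡ w ⟨$⟩ʳ y → x ≡ y
  w-injective {x} {y} wx≡wy = trans (sym (inverseˡ w)) (trans (cong (w ⟨$⟩ˡ_) wx≡wy) (inverseˡ w))

  skipped-row-straight : ∀ {r} → r < n → Rows.Skipped r → ∀ {b} → b < m → Straight (get B r (col b))
  skipped-row-straight {r} r<n skipped {b} b<m =
    subst (λ i → Straight (get B i (col b))) (toℕ-fromℕ< r<n)
      (removable-row-straight w (removable x x-notPos) bpd (col b) (Columns.lift<n b<m) col-b≢wx)
    where
    x = fromℕ< r<n
    x-notPos : NotPos s x
    x-notPos a sa≡x = skipped a (trans (cong toℕ sa≡x) (toℕ-fromℕ< r<n))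
    col-b≢wx : col b ≢ toℕ (w ⟨$⟩ʳ x)
    col-b≢wx col-b≡wx with t⊆w∘s (fromℕ< b<m)
    ... | a , tb≡wsa = x-notPos a (w-injective (trans (sym tb≡wsa)
                         (toℕ-injective (trans (sym (Columns.lift-fromℕ< b<m)) col-b≡wx))))

  skipped-column-straight : ∀ {c} → c < n → Columns.Skipped c →
                            ∀ {a} → a < m → Straight (get B (row a) c)
  skipped-column-straight {c} c<n skipped {a} a<m =
    subst (λ j → Straight (get B (row a) j)) wx≡c
      (removable-column-straight w (removable x x-notPos) bpd (row a) (Rows.lift<n a<m) row-a≢x)
    where
    x = w ⟨$⟩ˡ fromℕ< c<n
    wx≡c : toℕ (w ⟨$⟩ʳ x) ≡ c
    wx≡c = trans (cong toℕ (inverseʳ w)) (toℕ-fromℕ< c<n)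
    x-notPos : NotPos s x
    x-notPos a′ sa′≡x with w∘s⊆t a′
    ... | b , wsa′≡tb =
      skipped b (trans (cong toℕ (sym wsa′≡tb)) (trans (cong (λ i → toℕ (w ⟨$⟩ʳ i)) sa′≡x) wx≡c))
    row-a≢x : row a ≢ toℕ x
    row-a≢x row-a≡x = x-notPos (fromℕ< a<m) (toℕ-injective (trans (sym (Rows.lift-fromℕ< a<m)) row-a≡x))

  φ-isBPD : IsBPD φB
  φ-isBPD = isBPD-fromLines φB row-line column-line
    where
    row-line : ∀ {a} → a < m → IsLine westE eastE m (get φB a)
    row-line {a} a<m = IsLine-cong (sym ∘ get-φ a)
      (Columns.isLine-restrict (row-isLine B bpd (Rows.lift<n a<m))
        (λ _ c<n skipped → straight⇒westE≡eastE (skipped-column-straight c<n skipped a<m))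
        (≤-trans (s≤s z≤n) a<m))
    column-line : ∀ {b} → b < m → IsLine northE southE m (λ k → get φB k b)
    column-line {b} b<m = IsLine-cong (λ k → sym (get-φ k b))
      (Rows.isLine-restrict (column-isLine B bpd (Columns.lift<n b<m))
        (λ _ r<n skipped → straight⇒northE≡southE (skipped-row-straight r<n skipped b<m))
        (≤-trans (s≤s z≤n) b<m))

  embed : ℕ × ℕ → ℕ × ℕ
  embed (a , b) = row a , col b

  _↦_ : ℕ × ℕ → ℕ × ℕ → Set
  c ↦ d = embed c ≡ d

  open Walks B bpd _↦_

  mutual
    walk-embeds : ∀ f a b d → a < m → b < m → EmbedsInWalk (proj₁ (walk φB f a b d)) (row a) (col b) d
    walk-embeds zero    a b d _   _   g       _    = minimum _
    walk-embeds (suc f) a b d a<m b<m zero    fuel = ⊥-elim (fuel-positive (Columns.lift<n b<m) fuel)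
    walk-embeds (suc f) a b d a<m b<m (suc g) fuel = refl ∷
      subst (λ τ → Sublist _↦_ (proj₁ (continue φB f a b (next d τ)))
                               (proj₁ (continue B g (row a) (col b) (next d (get B (row a) (col b))))))
            (sym (get-φ a b))
            (continue-embeds f a b _ (next⇒exitE d _) a<m b<m g fuel)

    continue-embeds : ∀ f a b md → (∀ {d} → md ≡ just d → exitE d (get B (row a) (col b)) ≡ true) →
                      a < m → b < m → ∀ g → row a + (n ∸ col b) ≤ suc g →
                      Sublist _↦_ (proj₁ (continue φB f a b md)) (proj₁ (continue B g (row a) (col b) md))
    continue-embeds f a       b nothing      _    _     _   g _    = minimum _
    continue-embeds f zero    b (just north) _    _     _   g _    = minimum _
    continue-embeds f (suc a) b (just north) exit 1+a<m b<m g fuel =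
      north-gap (Columns.lift<n b<m) (Rows.lift-mono-< (n<1+n a) 1+a<m) (Rows.lift<n 1+a<m)
        (λ k lo hi → skipped-row-straight (<-trans hi (Rows.lift<n 1+a<m))
                                          (Rows.skipped-between 1+a<m lo hi) b<m)
        (exit refl) (walk-embeds f a b north (<-trans (n<1+n a) 1+a<m) b<m) g fuel
    continue-embeds f a b (just east) exit a<m b<m g fuel with suc b <? m
    ... | no 1+b≮m = subst (λ c → Sublist _↦_ (proj₁ c) _)
                       (sym (continue-exit φB f a b (≤-antisym b<m (≮⇒≥ 1+b≮m)))) (minimum _)
    ... | yes 1+b<m = subst (λ c → Sublist _↦_ (proj₁ c) _) (sym (continue-east φB f a b 1+b<m))
      (east-gap (Rows.lift<n a<m) (Columns.lift-mono-< (n<1+n b) 1+b<m) (Columns.lift<n 1+b<m)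
        (λ k lo hi → skipped-column-straight (<-trans hi (Columns.lift<n 1+b<m))
                                             (Columns.skipped-between 1+b<m lo hi) a<m)
        (exit refl) (walk-embeds f a (suc b) east a<m 1+b<m) g fuel)

  pipe-embeds : ∀ {p} → p < m → Sublist _↦_ (proj₁ (pipe φB p)) (proj₁ (pipe B (col p)))
  pipe-embeds {p} p<m =
    north-run col-p<n (<⇒≤pred (Rows.lift<n (pred<n p<m))) (pred<n col-p<n)
      (λ r lo hi → skipped-row-straight (≤-<-trans hi (pred<n col-p<n))
                                        (Rows.skipped-above (suc-pred-of p<m) lo) p<m)
      (bottomFull (col p) col-p<n) (walk-embeds (2 * m) (pred m) p north (pred<n p<m) p<m)
      (2 * n) (+-mono-≤ (m∸n≤m n 1) (≤-trans (m∸n≤m n (col p)) (m≤m+n n 0)))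
    where col-p<n = Columns.lift<n p<m

  φ-reduced : Reduced B → Reduced φB
  φ-reduced reduced p q p<m q<m p≢q = begin
    length (crossings φB p q)
      ≤⟨ length-mono-≤ (⊆-filter-Sublist (T? ∘ _) (T? ∘ _) crossing↦crossing (pipe-embeds p<m)) ⟩
    length (crossings B (col p) (col q))
      ≤⟨ reduced (col p) (col q) (Columns.lift<n p<m) (Columns.lift<n q<m)
                 (p≢q ∘ Columns.lift-injective p<m q<m) ⟩
    1 ∎
    where
    open ≤-Reasoning
    crossing↦crossing : ∀ {c d} → c ↦ d →
      T (memᵇ c (proj₁ (pipe φB q)) ∧ isCross (get φB (proj₁ c) (proj₂ c))) →
      T (memᵇ d (proj₁ (pipe B (col q))) ∧ isCross (get B (proj₁ d) (proj₂ d)))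
    crossing↦crossing {a , b} refl c-crossing = Equivalence.from T-∧
      ( memᵇ-Sublist embed (pipe-embeds q<m) (proj₁ both)
      , subst (T ∘ isCross) (get-φ a b) (proj₂ both) )
      where both = Equivalence.to T-∧ c-crossing

  countJ-φ : countJ B ≡ countJ φB
  countJ-φ = begin
    sum (map (λ i → sum (map (isJ-count ∘ B i) (allFin n))) (allFin n))
      ≡⟨ sum-map-allFin-restrict s s-increasing _ (λ x x-notPos →
           sum-map-zero _ (cong indicator ∘ removable-row-noJ w (removable x x-notPos) bpd) (allFin n)) ⟩
    sum (map (λ a → sum (map (isJ-count ∘ B (s a)) (allFin n))) (allFin m))
      ≡⟨ cong sum (map-cong (λ a → sum-map-allFin-restrict t t-increasing _ (λ y y-notPos →
           cong indicator (skipped-column-noJ a y y-notPos))) (allFin m)) ⟩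
    sum (map (λ a → sum (map (isJ-count ∘ B (s a) ∘ t) (allFin m))) (allFin m))
      ∎
    where
    open ≡-Reasoning
    indicator : Bool → ℕ
    indicator b = if b then 1 else 0
    isJ-count : Tile → ℕ
    isJ-count τ = indicator (isJ τ)
    skipped-column-noJ : ∀ a y → NotPos t y → isJ (B (s a) y) ≡ false
    skipped-column-noJ a y y-notPos = subst (λ τ → isJ τ ≡ false)
      (trans (cong (λ i → get B i (toℕ y)) (Rows.lift-toℕ a)) (get-toℕ B (s a) y))
      (straight⇒¬isJ (skipped-column-straight (toℕ<n y) (λ b → y-notPos b ∘ toℕ-injective) (toℕ<n a)))

mainTheorem5 : ∀ {c ℓ : Level} (R : CommutativeSemiring c ℓ) (β : CommutativeSemiring.Carrier R)
    (n m : ℕ) (w : Permutation′ n) (s t : Fin m → Fin n) →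
    StrictlyIncreasing s → StrictlyIncreasing t →
    (∀ a → ∃ λ b → w ⟨$⟩ʳ s a ≡ t b) → (∀ b → ∃ λ a → t b ≡ w ⟨$⟩ʳ s a) →
    (B : Grid n) → InBpd w s B →
    IsReducedBPD (φ s t B) × CommutativeSemiring._≈_ R (wt R β B) (wt R β (φ s t B))
mainTheorem5 R β n m w s t s-increasing t-increasing w∘s⊆t t⊆w∘s B
             ((bpd , reduced) , _ , removable⇔notPos) =
  (φ-isBPD , φ-reduced reduced) , CommutativeSemiring.reflexive R (cong (pow R (1# ⊕ β)) countJ-φ)
  where
  open CommutativeSemiring R using (1#) renaming (_+_ to _⊕_)
  open Subword w s t s-increasing t-increasing w∘s⊆t t⊆w∘s B bpd (λ x → proj₂ (removable⇔notPos x))
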